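{- Define integers $H_{4+6t}$ for $t\geq 0$ by $H_4=1+2+2^3+2^4=27$ and $H_{4+6(t+1)}=H_{4+6t}+(1+2+2^2)\,2^{6t+8}$. Let $T$ denote the map on odd positive integers $T(n)=(3n+1)/2^{\nu}$, where $2^\nu$ is the largest power of $2$ dividing $3n+1$. Then for every $t\geq 0$, with $k=3t+2$: $T(H_{2k})=\sum_{\mu=1}^{k+1}2^{2\mu-1}-1$, where this step divides $3H_{2k}+1$ by exactly $2^1$; and $T\big(T(H_{2k})\big)=2^{2k+1}-1$, where this step divides by exactly $2^2$.
   Context: In the paper's polynomial notation ($x\equiv 2$), this reads $F^{(2k-1)}_{2k}(x)=C_2[C_1[H_{2k}(x)]]$ with $F^{(2k-1)}_{2k}(x)=x^{2k}+x^{2k-1}+\cdots+x+1=2^{2k+1}-1$, for $2k=3\tau+1$ with $\tau=1,3,5,\dots$ (equivalently $2k=4+6t$), where $C_q[n]=(3n+1)/2^q$ with $q$ maximal. -}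

module Defs where

open import Data.Nat using (ℕ; zero; suc; _+_; _*_; _∸_; _^_)
open import Data.Nat.Divisibility using (_∣_)
open import Data.Product using (_×_)
open import Relation.Nullary using (¬_)
open import Relation.Binary.PropositionalEquality using (_≡_)

-- H t  represents  H_{4+6t}:  H_4 = 1+2+2^3+2^4,  H_{4+6(t+1)} = H_{4+6t} + (1+2+2^2) 2^{6t+8}
H : ℕ → ℕ
H zero    = 1 + 2 + 2 ^ 3 + 2 ^ 4
H (suc t) = H t + (1 + 2 + 2 ^ 2) * 2 ^ (6 * t + 8)

-- The Collatz-type map T(n) = (3n+1)/2^ν on odd positive n, with 2^ν the largest
-- power of 2 dividing 3n+1.  "T n = m, with this step dividing by exactly 2^ν"
-- is the relation TStep n ν m: n is odd, 3n+1 = 2^ν · m and m is odd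
-- (m odd  ⇔  2^ν is the largest power of 2 dividing 3n+1).
TStep : ℕ → ℕ → ℕ → Set
TStep n ν m = ¬ (2 ∣ n) × (3 * n + 1 ≡ 2 ^ ν * m) × ¬ (2 ∣ m)

oddPowSum : ℕ → ℕ
oddPowSum zero    = 0
oddPowSum (suc K) = oddPowSum K + 2 ^ (2 * suc K ∸ 1)

module Submission where

-- Both sequences in the statement have closed forms in powers of 2:
--     9 · H t + 13 = 2^(6t+8)          and          3 · oddPowSum K + 2 = 2^(2K+1).
-- Put Y = 2^(2k+1) with k = 3t+2, and M = oddPowSum (k+1) - 1.  The closed forms
-- turn into the two linear relations
--     9 · H t + 13 = 8 · Y             and          3 · M + 5 = 4 · Y,
-- and the whole theorem is a statement about numbers h, M, Y satisfying such
-- relations: from them alone, 3h + 1 = 2M and 3M + 1 = 4(Y - 1), while h, M and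
-- (for even Y) Y - 1 are odd.

open import Defs
open import Data.Nat using (ℕ; zero; suc; _+_; _*_; _∸_; _^_; _<_)
open import Data.Nat.Properties
  using (^-distribˡ-+-*; *-suc; +-comm; *-cancelˡ-≡; +-cancelʳ-≡; m∸n+n≡m; m^n>0; m≤n+m; ≤-trans)
open import Data.Nat.Divisibility using (_∣_; _∣?_; ∣m+n∣m⇒∣n; ∣m⇒∣m*n; ∣n⇒∣m*n; m∣m*n)
open import Data.Nat.Tactic.RingSolver using (solve-∀)
open import Data.Product using (_×_; _,_)
open import Relation.Binary.PropositionalEquality using (_≡_; refl; sym; trans; cong; subst; module ≡-Reasoning)
open import Relation.Nullary using (¬_)
open import Relation.Nullary.Decidable using (from-no)

odd-summand : ∀ {a b c} → a + b ≡ c → 2 ∣ c → ¬ 2 ∣ b → ¬ 2 ∣ a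
odd-summand a+b≡c 2∣c 2∤b 2∣a =
  2∤b (∣m+n∣m⇒∣n (subst (2 ∣_) (sym a+b≡c) 2∣c) 2∣a)

odd-factor : ∀ m {a} → ¬ 2 ∣ m * a → ¬ 2 ∣ a
odd-factor m 2∤ma 2∣a = 2∤ma (∣n⇒∣m*n m 2∣a)

pow2-split : ∀ a b c → a ≡ b + c → 2 ^ a ≡ 2 ^ b * 2 ^ c
pow2-split a b c a≡b+c = trans (cong (2 ^_) a≡b+c) (^-distribˡ-+-* 2 b c)

-- 9 · H_{4+6t} + 13 = 2^(6t+8): each step adds 63 · 2^(6t+8), multiplying by 64.
H-closed : ∀ t → 9 * H t + 13 ≡ 2 ^ (6 * t + 8)
H-closed zero = refl
H-closed (suc t) = begin
  9 * (H t + 7 * x) + 13  ≡⟨ regroup (H t) x ⟩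
  (9 * H t + 13) + 63 * x ≡⟨ cong (_+ 63 * x) (H-closed t) ⟩
  x + 63 * x              ≡⟨ times64 x ⟩
  2 ^ 6 * x               ≡⟨ sym (pow2-split (6 * suc t + 8) 6 (6 * t + 8) (exponent t)) ⟩
  2 ^ (6 * suc t + 8)     ∎
  where
  open ≡-Reasoning
  x : ℕ
  x = 2 ^ (6 * t + 8)
  regroup : ∀ h x → 9 * (h + 7 * x) + 13 ≡ (9 * h + 13) + 63 * x
  regroup = solve-∀
  times64 : ∀ x → x + 63 * x ≡ 64 * x
  times64 = solve-∀
  exponent : ∀ t → 6 * suc t + 8 ≡ 6 + (6 * t + 8)
  exponent = solve-∀

-- 3 · Σ_{μ=1}^{K} 2^(2μ-1) + 2 = 2^(2K+1): the geometric sum with ratio 4.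
oddPowSum-closed : ∀ K → 3 * oddPowSum K + 2 ≡ 2 ^ (2 * K + 1)
oddPowSum-closed zero = refl
oddPowSum-closed (suc K) = begin
  3 * (oddPowSum K + 2 ^ (2 * suc K ∸ 1)) + 2 ≡⟨ cong (λ e → 3 * (oddPowSum K + 2 ^ e) + 2) (new-exponent K) ⟩
  3 * (oddPowSum K + x) + 2                   ≡⟨ regroup (oddPowSum K) x ⟩
  (3 * oddPowSum K + 2) + 3 * x               ≡⟨ cong (_+ 3 * x) (oddPowSum-closed K) ⟩
  x + 3 * x                                   ≡⟨ times4 x ⟩
  2 ^ 2 * x                                   ≡⟨ sym (pow2-split (2 * suc K + 1) 2 (2 * K + 1) (exponent K)) ⟩
  2 ^ (2 * suc K + 1)                         ∎
  where
  open ≡-Reasoning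
  x : ℕ
  x = 2 ^ (2 * K + 1)
  new-exponent : ∀ K → 2 * suc K ∸ 1 ≡ 2 * K + 1
  new-exponent K = trans (cong (_∸ 1) (*-suc 2 K)) (+-comm 1 (2 * K))
  regroup : ∀ s x → 3 * (s + x) + 2 ≡ (3 * s + 2) + 3 * x
  regroup = solve-∀
  times4 : ∀ x → x + 3 * x ≡ 4 * x
  times4 = solve-∀
  exponent : ∀ K → 2 * suc K + 1 ≡ 2 + (2 * K + 1)
  exponent = solve-∀

-- A nonempty sum of positive powers of 2 is positive; needed to subtract 1 from it.
oddPowSum-pos : ∀ K → 0 < K → 0 < oddPowSum K
oddPowSum-pos (suc K) _ = ≤-trans (m^n>0 2 (2 * suc K ∸ 1)) (m≤n+m _ (oddPowSum K))

relation-pred : ∀ {S Y} → 0 < S → 3 * S + 2 ≡ 4 * Y → 3 * (S ∸ 1) + 5 ≡ 4 * Y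
relation-pred {S} 0<S relS =
  trans (shift (S ∸ 1)) (trans (cong (λ s → 3 * s + 2) (m∸n+n≡m 0<S)) relS)
  where
  shift : ∀ m → 3 * m + 5 ≡ 3 * (m + 1) + 2
  shift = solve-∀

odd-from-relation : ∀ {M} Y → 3 * M + 5 ≡ 4 * Y → ¬ 2 ∣ M
odd-from-relation Y rel =
  odd-factor 3 (odd-summand rel (∣m⇒∣m*n Y (m∣m*n 2)) (from-no (2 ∣? 5)))

halving-step : ∀ {h M} Y → 9 * h + 13 ≡ 8 * Y → 3 * M + 5 ≡ 4 * Y → TStep h 1 M
halving-step {h} {M} Y relH relM = odd-h , three-h+1 , odd-from-relation Y relM
  where
  open ≡-Reasoning
  odd-h : ¬ 2 ∣ h
  odd-h = odd-factor 9 (odd-summand relH (∣m⇒∣m*n Y (m∣m*n 4)) (from-no (2 ∣? 13)))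
  three-h+1 : 3 * h + 1 ≡ 2 * M
  three-h+1 = *-cancelˡ-≡ _ _ 3 (+-cancelʳ-≡ 10 _ _ (begin
    3 * (3 * h + 1) + 10 ≡⟨ expandH h ⟩
    9 * h + 13           ≡⟨ relH ⟩
    8 * Y                ≡⟨ double Y ⟩
    2 * (4 * Y)          ≡⟨ cong (2 *_) (sym relM) ⟩
    2 * (3 * M + 5)      ≡⟨ expandM M ⟩
    3 * (2 * M) + 10     ∎))
    where
    expandH : ∀ h → 3 * (3 * h + 1) + 10 ≡ 9 * h + 13
    expandH = solve-∀
    double : ∀ Y → 8 * Y ≡ 2 * (4 * Y)
    double = solve-∀
    expandM : ∀ M → 2 * (3 * M + 5) ≡ 3 * (2 * M) + 10
    expandM = solve-∀

quartering-step : ∀ {M P} Y → 3 * M + 5 ≡ 4 * Y → P + 1 ≡ Y → 2 ∣ Y → TStep M 2 P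
quartering-step {M} {P} Y relM P+1≡Y 2∣Y =
  odd-from-relation Y relM , three-M+1 , odd-summand P+1≡Y 2∣Y (from-no (2 ∣? 1))
  where
  open ≡-Reasoning
  three-M+1 : 3 * M + 1 ≡ 4 * P
  three-M+1 = +-cancelʳ-≡ 4 _ _ (begin
    3 * M + 1 + 4 ≡⟨ shift M ⟩
    3 * M + 5     ≡⟨ relM ⟩
    4 * Y         ≡⟨ cong (4 *_) (sym P+1≡Y) ⟩
    4 * (P + 1)   ≡⟨ expand P ⟩
    4 * P + 4     ∎)
    where
    shift : ∀ M → 3 * M + 1 + 4 ≡ 3 * M + 5
    shift = solve-∀
    expand : ∀ P → 4 * (P + 1) ≡ 4 * P + 4
    expand = solve-∀

mainTheorem5 : (t : ℕ) →
    TStep (H t) 1 (oddPowSum (3 * t + 2 + 1) ∸ 1)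
    × TStep (oddPowSum (3 * t + 2 + 1) ∸ 1) 2 (2 ^ (2 * (3 * t + 2) + 1) ∸ 1)
mainTheorem5 t = halving-step Y relH relM , quartering-step Y relM Y-pred Y-even
  where
  k e : ℕ
  k = 3 * t + 2
  e = 2 * k + 1
  S Y : ℕ
  S = oddPowSum (k + 1)
  Y = 2 ^ e
  relH : 9 * H t + 13 ≡ 8 * Y
  relH = trans (H-closed t) (pow2-split (6 * t + 8) 3 e (exponentH t))
    where
    exponentH : ∀ t → 6 * t + 8 ≡ 3 + (2 * (3 * t + 2) + 1)
    exponentH = solve-∀
  relS : 3 * S + 2 ≡ 4 * Y
  relS = trans (oddPowSum-closed (k + 1)) (pow2-split (2 * (k + 1) + 1) 2 e (exponentS k))
    where
    exponentS : ∀ k → 2 * (k + 1) + 1 ≡ 2 + (2 * k + 1)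
    exponentS = solve-∀
  relM : 3 * (S ∸ 1) + 5 ≡ 4 * Y
  relM = relation-pred {Y = Y} (oddPowSum-pos (k + 1) (m≤n+m 1 k)) relS
  Y-pred : Y ∸ 1 + 1 ≡ Y
  Y-pred = m∸n+n≡m (m^n>0 2 e)
  Y-even : 2 ∣ Y
  Y-even = subst (2 ∣_) (sym (pow2-split e 1 (2 * k) (+-comm (2 * k) 1))) (m∣m*n (2 ^ (2 * k)))
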